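{- Every tent is $(2P_3,C_4,C_6,C_7)$-free and contains an induced $T_0$.
   Context: All graphs are finite, simple and nonnull. $G$ is $H$-free if no induced subgraph is isomorphic to $H$; $P_k$, $C_k$ are the path and cycle on $k$ vertices; $2P_3$ is two disjoint copies of $P_3$. Cliques may be empty; complete/anticomplete between sets as usual. $T_0$ has vertices $a_0,a_1,b_0,b_1,b_2,b_3,c_1,c_2,c_3$ and edges $a_0a_1$, $a_0b_0,a_0b_2,a_0b_3$, $a_1b_1,a_1b_2,a_1b_3$, $c_1c_2,c_1c_3,c_2c_3$, $c_1b_0,c_1b_1$, $c_2b_2$, $c_3b_3$. Tent: a graph $G$ whose vertex set can be partitioned into sets $A_0,A_1,B_0,B_1,B_2,B_3,C_1,C_2,C_3,F_2,F_3,W,Y,Z$ such that: $A_0,A_1,B_0,\dots,B_3,C_1,C_2,C_3$ are nonempty cliques; $F_2,F_3,Y$ are cliques, at most one of which is nonempty; $W$ is a (possibly empty) clique; $A_0$ is complete to $A_1$; $A_0$ is complete to $B_0,B_2,B_3$ and anticomplete to $B_1,C_1,C_2,C_3$; $A_1$ is complete to $B_1,B_2,B_3$ and anticomplete to $B_0,C_1,C_2,C_3$; $B_0,\dots,B_3$ are pairwise anticomplete; $C_1,C_2,C_3$ are pairwise complete; $C_1$ is complete to $B_0,B_1$ and anticomplete to $B_2,B_3$; $C_2$ is complete to $B_2$ and anticomplete to $B_0,B_1,B_3$; $C_3$ is complete to $B_3$ and anticomplete to $B_0,B_1,B_2$; $F_2$ is complete to $A_0,A_1,B_0,B_1,B_3,C_1,C_3$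 and anticomplete to $B_2,C_2$; $F_3$ is complete to $A_0,A_1,B_0,B_1,B_2,C_1,C_2$ and anticomplete to $B_3,C_3$; $W$ is complete to $A_0,A_1,B_0,\dots,B_3,C_1,C_2,C_3,F_2,F_3$; $Y$ is complete to $C_2,C_3$ and anticomplete to $A_0,A_1,B_0,\dots,B_3,C_1$; $Z$ is anticomplete to $A_0,A_1,B_0,\dots,B_3,C_1,C_2,C_3,Y$; $Y$ can be ordered $Y=\{y_1,\dots,y_t\}$ with $N_G[y_t]\subseteq\dots\subseteq N_G[y_1]$; and if $Z\neq\emptyset$, then $Z$ can be partitioned into nonempty pairwise anticomplete cliques $Z_1,\dots,Z_\ell$, each ordered $Z_j=\{z^j_1,\dots,z^j_{t_j}\}$ with $N_G[z^j_{t_j}]\subseteq\dots\subseteq N_G[z^j_1]$. -}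

module Defs where

open import Data.Nat using (ℕ; zero; suc; _≡ᵇ_)
open import Data.Fin using (Fin; toℕ; zero; suc) renaming (_≤_ to _≤ᶠ_)
open import Data.Bool using (Bool; true; false; _∨_; _∧_)
open import Data.Bool.Properties using (∨-comm)
open import Data.List using (List; []; _∷_)
open import Data.Bool.ListAction using (any)
open import Data.List.Relation.Unary.All using (All)
open import Data.Product using (Σ; ∃; ∃-syntax; _×_; _,_)
open import Data.Sum using (_⊎_)
open import Relation.Nullary using (¬_)
open import Relation.Binary.PropositionalEquality using (_≡_; _≢_; refl)
open import Function.Definitions using (Injective)

record Graph : Set where
  field
    n      : ℕ
    adj    : Fin n → Fin n → Bool
    sym    : ∀ u v → adj u v ≡ adj v u
    irrefl : ∀ v → adj v v ≡ false

open Graph public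

E : (G : Graph) → Fin (n G) → Fin (n G) → Set
E G u v = adj G u v ≡ true

Contains : Graph → Graph → Set
Contains H G =
  Σ (Fin (n H) → Fin (n G)) λ f →
    Injective _≡_ _≡_ f × (∀ i j → adj H i j ≡ adj G (f i) (f j))

Free : Graph → Graph → Set
Free H G = ¬ Contains H G

edgeFn : {k : ℕ} → List (ℕ × ℕ) → Fin k → Fin k → Bool
edgeFn es i j = any (λ { (a , b) → (toℕ i ≡ᵇ a) ∧ (toℕ j ≡ᵇ b) }) es

mkGraph : (k : ℕ) (es : List (ℕ × ℕ)) →
          (∀ v → edgeFn {k} es v v ∨ edgeFn {k} es v v ≡ false) → Graph
mkGraph k es irr = record
  { n = k
  ; adj = λ i j → edgeFn es i j ∨ edgeFn es j i
  ; sym = λ i j → ∨-comm (edgeFn es i j) (edgeFn es j i)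
  ; irrefl = irr
  }

twoP3 : Graph
twoP3 = mkGraph 6 ((0 , 1) ∷ (1 , 2) ∷ (3 , 4) ∷ (4 , 5) ∷ []) irr
  where
  irr : _
  irr zero = refl
  irr (suc zero) = refl
  irr (suc (suc zero)) = refl
  irr (suc (suc (suc zero))) = refl
  irr (suc (suc (suc (suc zero)))) = refl
  irr (suc (suc (suc (suc (suc zero))))) = refl

C4 : Graph
C4 = mkGraph 4 ((0 , 1) ∷ (1 , 2) ∷ (2 , 3) ∷ (3 , 0) ∷ []) irr
  where
  irr : _
  irr zero = refl
  irr (suc zero) = refl
  irr (suc (suc zero)) = refl
  irr (suc (suc (suc zero))) = refl

C6 : Graph
C6 = mkGraph 6 ((0 , 1) ∷ (1 , 2) ∷ (2 , 3) ∷ (3 , 4) ∷ (4 , 5) ∷ (5 , 0) ∷ []) irr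
  where
  irr : _
  irr zero = refl
  irr (suc zero) = refl
  irr (suc (suc zero)) = refl
  irr (suc (suc (suc zero))) = refl
  irr (suc (suc (suc (suc zero)))) = refl
  irr (suc (suc (suc (suc (suc zero))))) = refl

C7 : Graph
C7 = mkGraph 7 ((0 , 1) ∷ (1 , 2) ∷ (2 , 3) ∷ (3 , 4) ∷ (4 , 5) ∷ (5 , 6) ∷ (6 , 0) ∷ []) irr
  where
  irr : _
  irr zero = refl
  irr (suc zero) = refl
  irr (suc (suc zero)) = refl
  irr (suc (suc (suc zero))) = refl
  irr (suc (suc (suc (suc zero)))) = refl
  irr (suc (suc (suc (suc (suc zero))))) = refl
  irr (suc (suc (suc (suc (suc (suc zero)))))) = refl

-- T0 : vertices a0=0, a1=1, b0=2, b1=3, b2=4, b3=5, c1=6, c2=7, c3=8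
T0 : Graph
T0 = mkGraph 9
  ( (0 , 1)
  ∷ (0 , 2) ∷ (0 , 4) ∷ (0 , 5)
  ∷ (1 , 3) ∷ (1 , 4) ∷ (1 , 5)
  ∷ (6 , 7) ∷ (6 , 8) ∷ (7 , 8)
  ∷ (6 , 2) ∷ (6 , 3)
  ∷ (7 , 4)
  ∷ (8 , 5)
  ∷ []) irr
  where
  irr : _
  irr zero = refl
  irr (suc zero) = refl
  irr (suc (suc zero)) = refl
  irr (suc (suc (suc zero))) = refl
  irr (suc (suc (suc (suc zero)))) = refl
  irr (suc (suc (suc (suc (suc zero))))) = refl
  irr (suc (suc (suc (suc (suc (suc zero)))))) = refl
  irr (suc (suc (suc (suc (suc (suc (suc zero))))))) = refl
  irr (suc (suc (suc (suc (suc (suc (suc (suc zero)))))))) = refl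

data Part : Set where
  A₀ A₁ B₀ B₁ B₂ B₃ C₁ C₂ C₃ F₂ F₃ W Y Z : Part

module _ (G : Graph) where
  private V = Fin (n G)

  ClosedN : V → V → Set
  ClosedN u w = (w ≡ u) ⊎ E G u w

  NestedOrdering : (V → Set) → Set
  NestedOrdering S =
    Σ ℕ λ t → Σ (Fin t → V) λ σ →
      Injective _≡_ _≡_ σ
      × (∀ i → S (σ i))
      × (∀ v → S v → ∃[ i ] σ i ≡ v)
      × (∀ i j → i ≤ᶠ j → ∀ w → ClosedN (σ j) w → ClosedN (σ i) w)

  module _ (part : V → Part) where
    Clique : Part → Set
    Clique P = ∀ u v → part u ≡ P → part v ≡ P → u ≢ v → E G u v

    NonEmpty : Part → Set
    NonEmpty P = ∃[ v ] part v ≡ P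

    Complete : Part → Part → Set
    Complete P Q = ∀ u v → part u ≡ P → part v ≡ Q → E G u v

    Anticomplete : Part → Part → Set
    Anticomplete P Q = ∀ u v → part u ≡ P → part v ≡ Q → ¬ E G u v

    CompleteTo : Part → List Part → Set
    CompleteTo P = All (Complete P)

    AnticompleteTo : Part → List Part → Set
    AnticompleteTo P = All (Anticomplete P)

    -- if Z ≠ ∅ then Z can be partitioned into nonempty pairwise
    -- anticomplete cliques Z₁,…,Z_ℓ, each with a nested ordering.
    -- (zc assigns each vertex an index; only its values on Z matter.)
    ZCondition : Set
    ZCondition =
      NonEmpty Z →
      Σ ℕ λ ℓ → Σ (V → Fin ℓ) λ zc →
        (∀ j → ∃[ v ] (part v ≡ Z × zc v ≡ j))
        × (∀ u v → part u ≡ Z → part v ≡ Z → zc u ≡ zc v → u ≢ v → E G u v)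
        × (∀ u v → part u ≡ Z → part v ≡ Z → zc u ≢ zc v → ¬ E G u v)
        × (∀ j → NestedOrdering (λ v → part v ≡ Z × zc v ≡ j))

    record IsTentPartition : Set where
      field
        cliques   : All Clique (A₀ ∷ A₁ ∷ B₀ ∷ B₁ ∷ B₂ ∷ B₃ ∷ C₁ ∷ C₂ ∷ C₃ ∷ F₂ ∷ F₃ ∷ Y ∷ W ∷ [])
        nonempty  : All NonEmpty (A₀ ∷ A₁ ∷ B₀ ∷ B₁ ∷ B₂ ∷ B₃ ∷ C₁ ∷ C₂ ∷ C₃ ∷ [])
        atMostOne : ¬ (NonEmpty F₂ × NonEmpty F₃)
                  × ¬ (NonEmpty F₂ × NonEmpty Y)
                  × ¬ (NonEmpty F₃ × NonEmpty Y)
        a₀a₁      : Complete A₀ A₁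
        a₀c       : CompleteTo A₀ (B₀ ∷ B₂ ∷ B₃ ∷ [])
        a₀a       : AnticompleteTo A₀ (B₁ ∷ C₁ ∷ C₂ ∷ C₃ ∷ [])
        a₁c       : CompleteTo A₁ (B₁ ∷ B₂ ∷ B₃ ∷ [])
        a₁a       : AnticompleteTo A₁ (B₀ ∷ C₁ ∷ C₂ ∷ C₃ ∷ [])
        b₀a       : AnticompleteTo B₀ (B₁ ∷ B₂ ∷ B₃ ∷ [])
        b₁a       : AnticompleteTo B₁ (B₂ ∷ B₃ ∷ [])
        b₂a       : AnticompleteTo B₂ (B₃ ∷ [])
        c₁c₂c₃    : Complete C₁ C₂ × Complete C₁ C₃ × Complete C₂ C₃
        c₁c       : CompleteTo C₁ (B₀ ∷ B₁ ∷ [])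
        c₁a       : AnticompleteTo C₁ (B₂ ∷ B₃ ∷ [])
        c₂c       : CompleteTo C₂ (B₂ ∷ [])
        c₂a       : AnticompleteTo C₂ (B₀ ∷ B₁ ∷ B₃ ∷ [])
        c₃c       : CompleteTo C₃ (B₃ ∷ [])
        c₃a       : AnticompleteTo C₃ (B₀ ∷ B₁ ∷ B₂ ∷ [])
        f₂c       : CompleteTo F₂ (A₀ ∷ A₁ ∷ B₀ ∷ B₁ ∷ B₃ ∷ C₁ ∷ C₃ ∷ [])
        f₂a       : AnticompleteTo F₂ (B₂ ∷ C₂ ∷ [])
        f₃c       : CompleteTo F₃ (A₀ ∷ A₁ ∷ B₀ ∷ B₁ ∷ B₂ ∷ C₁ ∷ C₂ ∷ [])
        f₃a       : AnticompleteTo F₃ (B₃ ∷ C₃ ∷ [])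
        wc        : CompleteTo W (A₀ ∷ A₁ ∷ B₀ ∷ B₁ ∷ B₂ ∷ B₃ ∷ C₁ ∷ C₂ ∷ C₃ ∷ F₂ ∷ F₃ ∷ [])
        yc        : CompleteTo Y (C₂ ∷ C₃ ∷ [])
        ya        : AnticompleteTo Y (A₀ ∷ A₁ ∷ B₀ ∷ B₁ ∷ B₂ ∷ B₃ ∷ C₁ ∷ [])
        za        : AnticompleteTo Z (A₀ ∷ A₁ ∷ B₀ ∷ B₁ ∷ B₂ ∷ B₃ ∷ C₁ ∷ C₂ ∷ C₃ ∷ Y ∷ [])
        yOrder    : NestedOrdering (λ v → part v ≡ Y)
        zCond     : ZCondition

  Tent : Set
  Tent = Σ (V → Part) IsTentPartition

{-# OPTIONS --safe #-}

-- The tent axioms prescribe, for every pair of parts, how two distinct vertices in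
-- them may be joined: always, never, not at all (the parts are not both nonempty), or,
-- inside Y and inside the cliques of Z, only with comparable closed neighbourhoods;
-- moreover Z induces no P₃.  These constraints pass to induced subgraphs, so an induced
-- 2P₃, C₄, C₆ or C₇ would carry a labelling of its vertices by parts satisfying them,
-- and an exhaustive search shows that none exists.  Conversely, one vertex from each
-- of the nonempty parts A₀, …, C₃ induces T₀, because the axioms prescribe every
-- adjacency between those parts.

module Submission where

open import Defs
open import Data.Product using (_×_; ∃-syntax; _,_; proj₁; proj₂; uncurry; swap)
open import Data.Bool using (Bool; true; false; T; _∨_)
import Data.Bool.Properties as Bool
open import Data.Bool.ListAction using (all)
open import Data.Empty using (⊥)
open import Data.Fin using (Fin)
import Data.Fin.Properties as Fin
open import Data.List using (List; []; _∷_; map; _++_; lookup; length; allFin)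
open import Data.List.Membership.Propositional using (_∈_)
open import Data.List.Membership.Propositional.Properties using (∈-lookup)
open import Data.List.Relation.Unary.All as All using (All; []; _∷_)
open import Data.List.Relation.Unary.All.Properties using (++⁺; all⁺) renaming (map⁺ to All-map⁺)
open import Data.List.Relation.Unary.Any as Any using (Any)
import Data.List.Relation.Unary.Any.Properties as Any
open import Data.Maybe using (Maybe; just; nothing; _<∣>_)
open import Data.Maybe.Relation.Unary.All as MaybeAll using (just; nothing)
import Data.Maybe.Relation.Unary.All.Properties as MaybeAll
open import Data.Maybe.Relation.Unary.Any as MaybeAny using (just)
open import Data.Nat using (ℕ)
import Data.Nat.Properties as ℕ
open import Data.Nat.DivMod using (_mod_)
open import Data.Sum using (_⊎_; inj₁; inj₂)
open import Function using (_∘_)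
open import Function.Bundles using (Equivalence)
open import Function.Definitions using (Injective)
open import Relation.Binary.Definitions using (DecidableEquality)
open import Relation.Binary.PropositionalEquality as ≡ using (_≡_; _≢_; refl; trans; cong; subst; subst₂)
open import Relation.Nullary using (¬_; Dec; yes; no; ¬?; _×-dec_; _⊎-dec_; _→-dec_)
open import Relation.Nullary.Decidable using (map′; True; isYes; toWitness; from-yes; decidable-stable)

allParts : List Part
allParts = A₀ ∷ A₁ ∷ B₀ ∷ B₁ ∷ B₂ ∷ B₃ ∷ C₁ ∷ C₂ ∷ C₃ ∷ F₂ ∷ F₃ ∷ W ∷ Y ∷ Z ∷ []

code : Part → ℕ
code A₀ = 0
code A₁ = 1
code B₀ = 2
code B₁ = 3
code B₂ = 4
code B₃ = 5
code C₁ = 6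
code C₂ = 7
code C₃ = 8
code F₂ = 9
code F₃ = 10
code W  = 11
code Y  = 12
code Z  = 13

-- Reducing modulo the number of parts makes decode total with values in allParts.
decode : ℕ → Part
decode k = lookup allParts (k mod length allParts)

decode-code : ∀ P → decode (code P) ≡ P
decode-code A₀ = refl
decode-code A₁ = refl
decode-code B₀ = refl
decode-code B₁ = refl
decode-code B₂ = refl
decode-code B₃ = refl
decode-code C₁ = refl
decode-code C₂ = refl
decode-code C₃ = refl
decode-code F₂ = refl
decode-code F₃ = refl
decode-code W  = refl
decode-code Y  = refl
decode-code Z  = refl

∈-allParts : ∀ P → P ∈ allParts
∈-allParts P = subst (_∈ allParts) (decode-code P) (∈-lookup (code P mod length allParts))

code-injective : Injective _≡_ _≡_ code
code-injective {P} {Q} eq = begin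
  P               ≡⟨ decode-code P ⟨
  decode (code P) ≡⟨ cong decode eq ⟩
  decode (code Q) ≡⟨ decode-code Q ⟩
  Q               ∎
  where open ≡.≡-Reasoning

infix 4 _≟ᴾ_
_≟ᴾ_ : DecidableEquality Part
P ≟ᴾ Q = map′ code-injective (cong code) (code P ℕ.≟ code Q)

open import Data.List.Membership.DecPropositional _≟ᴾ_ using () renaming (_∈?_ to _∈ᴾ?_)

-- The nested orderings make any two closed neighbourhoods inside Y comparable, and
-- likewise inside each clique Z_j, i.e. for any two adjacent vertices of Z.
data Link : Set where
  complete anticomplete exclusive nestedClique nestedIfAdjacent : Link

module _ (G : Graph) where
  private V = Fin (n G)

  Protrudes : V → V → Set
  Protrudes u v = ∃[ a ] ClosedN G u a × ¬ ClosedN G v a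

  Incomparable : V → V → Set
  Incomparable u v = Protrudes u v × Protrudes v u

  InducedP₃ : V → V → V → Set
  InducedP₃ u v w = E G u v × E G v w × u ≢ w × ¬ E G u w

  Allows : Link → V → V → Set
  Allows complete         u v = E G u v
  Allows anticomplete     u v = adj G u v ≡ false
  Allows exclusive        _ _ = ⊥
  Allows nestedClique     u v = E G u v × ¬ Incomparable u v
  Allows nestedIfAdjacent u v = E G u v → ¬ Incomparable u v

  Allows-sym : ∀ l {u v} → Allows l u v → Allows l v u
  Allows-sym complete         {u} {v} uv         = trans (sym G v u) uv
  Allows-sym anticomplete     {u} {v} uv         = trans (sym G v u) uv
  Allows-sym nestedClique     {u} {v} (uv , inc) = trans (sym G v u) uv , inc ∘ swap
  Allows-sym nestedIfAdjacent {u} {v} nested vu  = nested (trans (sym G u v) vu) ∘ swap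

infix 6 _↦_
_↦_ : List Part → Link → List (Part × Link)
Qs ↦ l = map (_, l) Qs

linkRules : Part → List (Part × Link)
linkRules A₀ = (A₀ ∷ A₁ ∷ B₀ ∷ B₂ ∷ B₃ ∷ []) ↦ complete ++ (B₁ ∷ C₁ ∷ C₂ ∷ C₃ ∷ []) ↦ anticomplete
linkRules A₁ = (A₁ ∷ B₁ ∷ B₂ ∷ B₃ ∷ []) ↦ complete ++ (B₀ ∷ C₁ ∷ C₂ ∷ C₃ ∷ []) ↦ anticomplete
linkRules B₀ = (B₀ ∷ []) ↦ complete ++ (B₁ ∷ B₂ ∷ B₃ ∷ []) ↦ anticomplete
linkRules B₁ = (B₁ ∷ []) ↦ complete ++ (B₂ ∷ B₃ ∷ []) ↦ anticomplete
linkRules B₂ = (B₂ ∷ []) ↦ complete ++ (B₃ ∷ []) ↦ anticomplete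
linkRules B₃ = (B₃ ∷ []) ↦ complete
linkRules C₁ = (C₁ ∷ C₂ ∷ C₃ ∷ B₀ ∷ B₁ ∷ []) ↦ complete ++ (B₂ ∷ B₃ ∷ []) ↦ anticomplete
linkRules C₂ = (C₂ ∷ C₃ ∷ B₂ ∷ []) ↦ complete ++ (B₀ ∷ B₁ ∷ B₃ ∷ []) ↦ anticomplete
linkRules C₃ = (C₃ ∷ B₃ ∷ []) ↦ complete ++ (B₀ ∷ B₁ ∷ B₂ ∷ []) ↦ anticomplete
linkRules F₂ = (F₂ ∷ A₀ ∷ A₁ ∷ B₀ ∷ B₁ ∷ B₃ ∷ C₁ ∷ C₃ ∷ []) ↦ complete ++ (B₂ ∷ C₂ ∷ []) ↦ anticomplete
            ++ (F₃ ∷ Y ∷ []) ↦ exclusive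
linkRules F₃ = (F₃ ∷ A₀ ∷ A₁ ∷ B₀ ∷ B₁ ∷ B₂ ∷ C₁ ∷ C₂ ∷ []) ↦ complete ++ (B₃ ∷ C₃ ∷ []) ↦ anticomplete
            ++ (Y ∷ []) ↦ exclusive
linkRules W  = (W ∷ A₀ ∷ A₁ ∷ B₀ ∷ B₁ ∷ B₂ ∷ B₃ ∷ C₁ ∷ C₂ ∷ C₃ ∷ F₂ ∷ F₃ ∷ []) ↦ complete
linkRules Y  = (Y ∷ []) ↦ nestedClique ++ (C₂ ∷ C₃ ∷ []) ↦ complete
            ++ (A₀ ∷ A₁ ∷ B₀ ∷ B₁ ∷ B₂ ∷ B₃ ∷ C₁ ∷ []) ↦ anticomplete
linkRules Z  = (Z ∷ []) ↦ nestedIfAdjacent ++ (A₀ ∷ A₁ ∷ B₀ ∷ B₁ ∷ B₂ ∷ B₃ ∷ C₁ ∷ C₂ ∷ C₃ ∷ Y ∷ []) ↦ anticomplete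

lookupLink : Part → List (Part × Link) → Maybe Link
lookupLink Q []                  = nothing
lookupLink Q ((Q′ , l) ∷ rules) with Q ≟ᴾ Q′
... | yes _ = just l
... | no  _ = lookupLink Q rules

link : Part → Part → Maybe Link
link P Q = lookupLink Q (linkRules P) <∣> lookupLink P (linkRules Q)

module _ (G : Graph) (ℓ : Fin (n G) → Part) where

  Forces : Part → Part → Link → Set
  Forces P Q l = ∀ {u v} → ℓ u ≡ P → ℓ v ≡ Q → u ≢ v → Allows G l u v

  forces-sym : ∀ {P Q l} → Forces P Q l → Forces Q P l
  forces-sym {l = l} forces eu ev u≢v = Allows-sym G l (forces ev eu (u≢v ∘ ≡.sym))

  lookupLink-sound : ∀ P Q {rules} → All (uncurry (Forces P)) rules →
                     MaybeAll.All (Forces P Q) (lookupLink Q rules)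
  lookupLink-sound P Q [] = nothing
  lookupLink-sound P Q {(Q′ , _) ∷ _} (forces ∷ rest) with Q ≟ᴾ Q′
  ... | yes refl = just forces
  ... | no  _    = lookupLink-sound P Q rest

nestedOrdering-comparable : ∀ G (S : Fin (n G) → Set) → NestedOrdering G S →
                            ∀ {u v} → S u → S v → ¬ Incomparable G u v
nestedOrdering-comparable _ _ (_ , _ , _ , _ , onto , nested) Su Sv ((a , ua , ¬va) , (b , vb , ¬ub))
  with onto _ Su | onto _ Sv
... | i , refl | j , refl with Fin.≤-total i j
...   | inj₁ i≤j = ¬ub (nested i j i≤j b vb)
...   | inj₂ j≤i = ¬va (nested j i j≤i a ua)

record Admissible (G : Graph) (ℓ : Fin (n G) → Part) : Set where
  field
    linked    : ∀ {u v} → u ≢ v → MaybeAll.All (λ l → Allows G l u v) (link (ℓ u) (ℓ v))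
    Z-P₃-free : ∀ {u v w} → ℓ u ≡ Z → ℓ v ≡ Z → ℓ w ≡ Z → ¬ InducedP₃ G u v w

cliqueParts : List Part
cliqueParts = A₀ ∷ A₁ ∷ B₀ ∷ B₁ ∷ B₂ ∷ B₃ ∷ C₁ ∷ C₂ ∷ C₃ ∷ F₂ ∷ F₃ ∷ Y ∷ W ∷ []

module _ {G : Graph} {ℓ : Fin (n G) → Part} (tp : IsTentPartition G ℓ) where
  open IsTentPartition tp

  private
    clique : ∀ P → {True (P ∈ᴾ? cliqueParts)} → Forces G ℓ P P complete
    clique P {P∈} eu ev u≢v = All.lookup cliques (toWitness P∈) _ _ eu ev u≢v

    complete⇒forces : ∀ {P Q} → Complete G ℓ P Q → Forces G ℓ P Q complete
    complete⇒forces P~Q eu ev _ = P~Q _ _ eu ev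

    anticomplete⇒forces : ∀ {P Q} → Anticomplete G ℓ P Q → Forces G ℓ P Q anticomplete
    anticomplete⇒forces P≁Q eu ev _ = Bool.¬-not (P≁Q _ _ eu ev)

    exclusive⇒forces : ∀ {P Q} → ¬ (NonEmpty G ℓ P × NonEmpty G ℓ Q) → Forces G ℓ P Q exclusive
    exclusive⇒forces ¬PQ eu ev _ = ¬PQ ((_ , eu) , (_ , ev))

    completes : ∀ {P Qs} → CompleteTo G ℓ P Qs → All (uncurry (Forces G ℓ P)) (Qs ↦ complete)
    completes = All-map⁺ ∘ All.map complete⇒forces

    anticompletes : ∀ {P Qs} → AnticompleteTo G ℓ P Qs → All (uncurry (Forces G ℓ P)) (Qs ↦ anticomplete)
    anticompletes = All-map⁺ ∘ All.map anticomplete⇒forces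

    same-class : ∀ {m} (class : Fin (n G) → Fin m) →
                 (∀ u v → ℓ u ≡ Z → ℓ v ≡ Z → class u ≢ class v → ¬ E G u v) →
                 ∀ {u v} → ℓ u ≡ Z → ℓ v ≡ Z → E G u v → class u ≡ class v
    same-class class apart eu ev uv = decidable-stable (class _ Fin.≟ class _) λ ne → apart _ _ eu ev ne uv

    Y-nested : Forces G ℓ Y Y nestedClique
    Y-nested eu ev u≢v = clique Y eu ev u≢v , nestedOrdering-comparable G (λ v → ℓ v ≡ Y) yOrder eu ev

    Z-nested : Forces G ℓ Z Z nestedIfAdjacent
    Z-nested {u} eu ev _ uv with zCond (u , eu)
    ... | _ , class , _ , _ , apart , ordered =
      nestedOrdering-comparable G (λ v → ℓ v ≡ Z × class v ≡ class u) (ordered (class u))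
        (eu , refl) (ev , ≡.sym (same-class class apart eu ev uv))

  linkRules-sound : ∀ P → All (uncurry (Forces G ℓ P)) (linkRules P)
  linkRules-sound A₀ = clique A₀ ∷ complete⇒forces a₀a₁ ∷ ++⁺ (completes a₀c) (anticompletes a₀a)
  linkRules-sound A₁ = clique A₁ ∷ ++⁺ (completes a₁c) (anticompletes a₁a)
  linkRules-sound B₀ = clique B₀ ∷ anticompletes b₀a
  linkRules-sound B₁ = clique B₁ ∷ anticompletes b₁a
  linkRules-sound B₂ = clique B₂ ∷ anticompletes b₂a
  linkRules-sound B₃ = clique B₃ ∷ []
  linkRules-sound C₁ = clique C₁ ∷ complete⇒forces (proj₁ c₁c₂c₃) ∷ complete⇒forces (proj₁ (proj₂ c₁c₂c₃))
                     ∷ ++⁺ (completes c₁c) (anticompletes c₁a)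
  linkRules-sound C₂ = clique C₂ ∷ complete⇒forces (proj₂ (proj₂ c₁c₂c₃)) ∷ ++⁺ (completes c₂c) (anticompletes c₂a)
  linkRules-sound C₃ = clique C₃ ∷ ++⁺ (completes c₃c) (anticompletes c₃a)
  linkRules-sound F₂ = clique F₂ ∷ ++⁺ (completes f₂c) (++⁺ (anticompletes f₂a)
                         (exclusive⇒forces (proj₁ atMostOne) ∷ exclusive⇒forces (proj₁ (proj₂ atMostOne)) ∷ []))
  linkRules-sound F₃ = clique F₃ ∷ ++⁺ (completes f₃c) (++⁺ (anticompletes f₃a)
                         (exclusive⇒forces (proj₂ (proj₂ atMostOne)) ∷ []))
  linkRules-sound W  = clique W ∷ completes wc
  linkRules-sound Y  = Y-nested ∷ ++⁺ (completes yc) (anticompletes ya)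
  linkRules-sound Z  = Z-nested ∷ anticompletes za

  link-sound : ∀ P Q → MaybeAll.All (Forces G ℓ P Q) (link P Q)
  link-sound P Q =
    MaybeAll.<∣>⁺ (lookupLink-sound G ℓ P Q (linkRules-sound P))
                  (MaybeAll.map (forces-sym G ℓ) (lookupLink-sound G ℓ Q P (linkRules-sound Q)))

  tent-admissible : Admissible G ℓ
  tent-admissible = record
    { linked    = λ u≢v → MaybeAll.map (λ forces → forces refl refl u≢v) (link-sound _ _)
    ; Z-P₃-free = Z-P₃-free
    }
    where
    Z-P₃-free : ∀ {u v w} → ℓ u ≡ Z → ℓ v ≡ Z → ℓ w ≡ Z → ¬ InducedP₃ G u v w
    Z-P₃-free {u} {v} {w} eu ev ew (uv , vw , u≢w , ¬uw) with zCond (u , eu)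
    ... | _ , class , _ , together , apart , _ =
      ¬uw (together u w eu ew (trans (same-class class apart eu ev uv) (same-class class apart ev ew vw)) u≢w)

module _ {H G : Graph} {f : Fin (n H) → Fin (n G)}
         (f-injective : Injective _≡_ _≡_ f) (f-adj : ∀ i j → adj H i j ≡ adj G (f i) (f j)) where

  E-preserved : ∀ {i j} → E H i j → E G (f i) (f j)
  E-preserved {i} {j} = trans (≡.sym (f-adj i j))

  E-reflected : ∀ {i j} → E G (f i) (f j) → E H i j
  E-reflected {i} {j} = trans (f-adj i j)

  ClosedN-preserved : ∀ {u a} → ClosedN H u a → ClosedN G (f u) (f a)
  ClosedN-preserved (inj₁ refl) = inj₁ refl
  ClosedN-preserved (inj₂ ua)   = inj₂ (E-preserved ua)

  ClosedN-reflected : ∀ {u a} → ClosedN G (f u) (f a) → ClosedN H u a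
  ClosedN-reflected (inj₁ fa≡fu) = inj₁ (f-injective fa≡fu)
  ClosedN-reflected (inj₂ ua)    = inj₂ (E-reflected ua)

  Protrudes-preserved : ∀ {u v} → Protrudes H u v → Protrudes G (f u) (f v)
  Protrudes-preserved (a , ua , ¬va) = f a , ClosedN-preserved ua , ¬va ∘ ClosedN-reflected

  Incomparable-preserved : ∀ {u v} → Incomparable H u v → Incomparable G (f u) (f v)
  Incomparable-preserved (uv , vu) = Protrudes-preserved uv , Protrudes-preserved vu

  Allows-reflected : ∀ l {u v} → Allows G l (f u) (f v) → Allows H l u v
  Allows-reflected complete         uv         = E-reflected uv
  Allows-reflected anticomplete     {u} {v} uv = trans (f-adj u v) uv
  Allows-reflected nestedClique     (uv , inc) = E-reflected uv , inc ∘ Incomparable-preserved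
  Allows-reflected nestedIfAdjacent nested uv  = nested (E-preserved uv) ∘ Incomparable-preserved

  admissible-∘ : ∀ {ℓ} → Admissible G ℓ → Admissible H (ℓ ∘ f)
  admissible-∘ admissible = record
    { linked    = λ u≢v → MaybeAll.map (λ {l} → Allows-reflected l) (linked (u≢v ∘ f-injective))
    ; Z-P₃-free = λ eu ev ew (uv , vw , u≢w , ¬uw) →
        Z-P₃-free eu ev ew (E-preserved uv , E-preserved vw , u≢w ∘ f-injective , ¬uw ∘ E-reflected)
    }
    where open Admissible admissible

module Backtracking {V L : Set} (labels : List L)
                    {Conflict : V × L → List (V × L) → Set}
                    (conflict? : ∀ x xs → Dec (Conflict x xs)) where

  refute : List V → List (V × L) → Bool
  refute []       _  = false
  refute (i ∷ is) xs = all (λ p → isYes (conflict? (i , p) xs) ∨ refute is ((i , p) ∷ xs)) labels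

  refute-sound : (σ : V → L) → (∀ p → p ∈ labels) →
                 (∀ i js → ¬ Conflict (i , σ i) (map (λ j → j , σ j) js)) →
                 ∀ is js → ¬ T (refute is (map (λ j → j , σ j) js))
  refute-sound σ ∈-labels consistent (i ∷ is) js refuted
    with Equivalence.to Bool.T-∨ (All.lookup (all⁺ _ labels refuted) (∈-labels (σ i)))
  ... | inj₁ conflict = consistent i js (toWitness conflict)
  ... | inj₂ refuted′ = refute-sound σ ∈-labels consistent is (i ∷ js) refuted′

module _ (G : Graph) where
  private V = Fin (n G)

  Clash : V × Part → V × Part → Set
  Clash (u , p) (v , q) = MaybeAny.Any (λ l → ¬ Allows G l u v) (link p q) × u ≢ v

  ZPath : V × Part → V × Part → V × Part → Set
  ZPath (u , p) (v , q) (w , r) = p ≡ Z × q ≡ Z × r ≡ Z × InducedP₃ G u v w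

  -- The guard on the label of x only serves to prune the search.
  Conflict : V × Part → List (V × Part) → Set
  Conflict x ys = Any (Clash x) ys ⊎ proj₂ x ≡ Z × Any (λ y → Any (λ z → ZPath x y z ⊎ ZPath y x z) ys) ys

  E? : ∀ u v → Dec (E G u v)
  E? u v = adj G u v Bool.≟ true

  ClosedN? : ∀ u a → Dec (ClosedN G u a)
  ClosedN? u a = a Fin.≟ u ⊎-dec E? u a

  Incomparable? : ∀ u v → Dec (Incomparable G u v)
  Incomparable? u v = protrudes? u v ×-dec protrudes? v u
    where
    protrudes? : ∀ u v → Dec (Protrudes G u v)
    protrudes? u v = Fin.any? λ a → ClosedN? u a ×-dec ¬? (ClosedN? v a)

  allows? : ∀ l u v → Dec (Allows G l u v)
  allows? complete         u v = E? u v
  allows? anticomplete     u v = adj G u v Bool.≟ false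
  allows? exclusive        _ _ = no λ ()
  allows? nestedClique     u v = E? u v ×-dec ¬? (Incomparable? u v)
  allows? nestedIfAdjacent u v = E? u v →-dec ¬? (Incomparable? u v)

  clash? : ∀ x y → Dec (Clash x y)
  clash? (u , p) (v , q) = MaybeAny.dec (λ l → ¬? (allows? l u v)) (link p q) ×-dec ¬? (u Fin.≟ v)

  ZPath? : ∀ x y z → Dec (ZPath x y z)
  ZPath? (u , p) (v , q) (w , r) =
    p ≟ᴾ Z ×-dec q ≟ᴾ Z ×-dec r ≟ᴾ Z ×-dec E? u v ×-dec E? v w ×-dec ¬? (u Fin.≟ w) ×-dec ¬? (E? u w)

  conflict? : ∀ x ys → Dec (Conflict x ys)
  conflict? x ys = Any.any? (clash? x) ys
             ⊎-dec proj₂ x ≟ᴾ Z ×-dec Any.any? (λ y → Any.any? (λ z → ZPath? x y z ⊎-dec ZPath? y x z) ys) ys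

  module _ {ℓ : V → Part} (admissible : Admissible G ℓ) where
    open Admissible admissible

    no-clash : ∀ {u v} → ¬ Clash (u , ℓ u) (v , ℓ v)
    no-clash (disallowed , u≢v) = contradicts (linked u≢v) disallowed
      where
      contradicts : ∀ {A : Set} {P : A → Set} {m} → MaybeAll.All P m → ¬ MaybeAny.Any (¬_ ∘ P) m
      contradicts (just p) (just ¬p) = ¬p p

    no-ZPath : ∀ {u v w} → ¬ ZPath (u , ℓ u) (v , ℓ v) (w , ℓ w)
    no-ZPath (eu , ev , ew , p₃) = Z-P₃-free eu ev ew p₃

    no-conflict : ∀ u vs → ¬ Conflict (u , ℓ u) (map (λ v → v , ℓ v) vs)
    no-conflict u vs (inj₁ clash) = no-clash (proj₂ (Any.satisfied (Any.map⁻ clash)))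
    no-conflict u vs (inj₂ (_ , paths)) with Any.satisfied (Any.map⁻ paths)
    ... | _ , paths′ with Any.satisfied (Any.map⁻ paths′)
    ...   | _ , inj₁ path = no-ZPath path
    ...   | _ , inj₂ path = no-ZPath path

refuted : Graph → Bool
refuted H = Backtracking.refute allParts (conflict? H) (allFin (n H)) []

refuted-sound : ∀ H → refuted H ≡ true → ∀ ℓ → ¬ Admissible H ℓ
refuted-sound H r ℓ admissible =
  Backtracking.refute-sound allParts (conflict? H) ℓ ∈-allParts (no-conflict H admissible) (allFin (n H)) []
    (Equivalence.from Bool.T-≡ r)

free-if-refuted : ∀ H {G} → refuted H ≡ true → Tent G → Free H G
free-if-refuted H r (ℓ , tp) (f , f-injective , f-adj) =
  refuted-sound H r (ℓ ∘ f) (admissible-∘ f-injective f-adj (tent-admissible tp))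

Determines : Link → Bool → Set
Determines complete     b = b ≡ true
Determines anticomplete b = b ≡ false
Determines _            _ = ⊥

determines? : ∀ l b → Dec (Determines l b)
determines? complete         b = b Bool.≟ true
determines? anticomplete     b = b Bool.≟ false
determines? exclusive        _ = no λ ()
determines? nestedClique     _ = no λ ()
determines? nestedIfAdjacent _ = no λ ()

allows-determines : ∀ {G} l {u v b} → Allows G l u v → Determines l b → adj G u v ≡ b
allows-determines complete     uv refl = uv
allows-determines anticomplete uv refl = uv

contains-by-labels : ∀ H {G ℓ} → Admissible G ℓ → (κ : Fin (n H) → Part) →
                     (∀ i → NonEmpty G ℓ (κ i)) → (∀ i j → κ i ≡ κ j → i ≡ j) →
                     (∀ i j → i ≢ j → MaybeAny.Any (λ l → Determines l (adj H i j)) (link (κ i) (κ j))) →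
                     Contains H G
contains-by-labels H {G} {ℓ} admissible κ inhabited κ-injective κ-determined = f , f-injective , f-adj
  where
  f : Fin (n H) → Fin (n G)
  f i = proj₁ (inhabited i)

  ℓ∘f≡κ : ∀ i → ℓ (f i) ≡ κ i
  ℓ∘f≡κ i = proj₂ (inhabited i)

  f-injective : Injective _≡_ _≡_ f
  f-injective {i} {j} e = κ-injective i j (trans (≡.sym (ℓ∘f≡κ i)) (trans (cong ℓ e) (ℓ∘f≡κ j)))

  f-adj : ∀ i j → adj H i j ≡ adj G (f i) (f j)
  f-adj i j with i Fin.≟ j
  ... | yes refl = trans (irrefl H i) (≡.sym (irrefl G (f i)))
  ... | no  i≢j  = ≡.sym (agree (κ-determined i j i≢j)
                                (subst₂ (λ P Q → MaybeAll.All (λ l → Allows G l (f i) (f j)) (link P Q))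
                                        (ℓ∘f≡κ i) (ℓ∘f≡κ j) (Admissible.linked admissible (i≢j ∘ f-injective))))
    where
    agree : ∀ {m} → MaybeAny.Any (λ l → Determines l (adj H i j)) m →
            MaybeAll.All (λ l → Allows G l (f i) (f j)) m → adj G (f i) (f j) ≡ adj H i j
    agree (just {l} determined) (just allowed) = allows-determines l allowed determined

-- T₀ numbers its vertices a₀, a₁, b₀, …, c₃ in the order of these parts.
T0-parts : List Part
T0-parts = A₀ ∷ A₁ ∷ B₀ ∷ B₁ ∷ B₂ ∷ B₃ ∷ C₁ ∷ C₂ ∷ C₃ ∷ []

T0-label : Fin (n T0) → Part
T0-label = lookup T0-parts

T0-label-injective : ∀ i j → T0-label i ≡ T0-label j → i ≡ j
T0-label-injective = from-yes (Fin.all? λ i → Fin.all? λ j → T0-label i ≟ᴾ T0-label j →-dec i Fin.≟ j)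

T0-determined : ∀ i j → i ≢ j → MaybeAny.Any (λ l → Determines l (adj T0 i j)) (link (T0-label i) (T0-label j))
T0-determined = from-yes (Fin.all? λ i → Fin.all? λ j →
  ¬? (i Fin.≟ j) →-dec MaybeAny.dec (λ l → determines? l (adj T0 i j)) (link (T0-label i) (T0-label j)))

tent-contains-T0 : ∀ {G} → Tent G → Contains T0 G
tent-contains-T0 (ℓ , tp) =
  contains-by-labels T0 (tent-admissible tp) T0-label
    (λ i → All.lookup (IsTentPartition.nonempty tp) (∈-lookup {xs = T0-parts} i))
    T0-label-injective T0-determined

proposition4p4 : (G : Graph) → Tent G →
    Free twoP3 G × Free C4 G × Free C6 G × Free C7 G × Contains T0 G
proposition4p4 G tent =
    free-if-refuted twoP3 refl tent
  , free-if-refuted C4 refl tent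
  , free-if-refuted C6 refl tent
  , free-if-refuted C7 refl tent
  , tent-contains-T0 tent
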